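{- $LTS(\mathrm{CLL}_R)$ is a Logic LTS, i.e. for every process $p$: (LTS1) if there is $\alpha\in\mathcal I(p)$ such that every $q$ with $p\stackrel{\alpha}{\longrightarrow}q$ satisfies $q\in F$, then $p\in F$; (LTS2) if there is no $q$ with $p\stackrel{\epsilon}{\Longrightarrow}_F|q$, then $p\in F$.
   Context: Fix a set $Act$ of visible actions and let $Act_\tau=Act\cup\{\tau\}$; $a$ ranges over $Act$, $\alpha$ over $Act_\tau$. Terms of $\mathrm{CLL}_R$: $t::=0\mid\bot\mid\alpha.t\mid t\Box t\mid t\wedge t\mid t\vee t\mid t\parallel_A t\mid X\mid\langle X|E\rangle$, where $X$ is a variable, $A\subseteq Act$, and $E$ is a recursive specification, i.e. a finite nonempty set of equations $\{Y=t_Y:Y\in V\}$ over a set $V$ of variables with $X\in V$ (variables of $V$ are bound in $\langle X|E\rangle$; recursive variables of distinct specifications are distinct and never occur free). A process is a closed term. For $E$ over $V$, $\langle t|E\rangle$ is $t$ with every free occurrence of each $Y\in V$ replaced by $\langle Y|E\rangle$. All recursive specifications are assumed guarded: every occurrence of every $Y\in V$ in every right-hand side of $E$ lies within a subterm $\alpha.t'$ or $t_1\vee t_2$. $LTS(\mathrm{CLL}_R)$ has the processes as states, transitions $\stackrel{\alpha}{\longrightarrow}$ and inconsistency predicate $F$ given by the unique stable model of the following stratified transition system specification ($x\not\stackrel{\alpha}{\longrightarrow}$: no $\alpha$-transition; $z\stackrel{\epsilon}{\Longrightarrow}|y$: $z(\stackrel{\tau}{\longrightarrow})^*y$ and $y\not\stackrel{\tau}{\longrightarrow}$).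 Operational rules: $\alpha.x\stackrel{\alpha}{\to}x$; if $x_1\stackrel{a}{\to}y_1$, $x_2\not\stackrel{\tau}{\to}$ then $x_1\Box x_2\stackrel a\to y_1$ and $x_2\Box x_1\stackrel a\to y_1$; if $x_1\stackrel\tau\to y_1$ then $x_1\Box x_2\stackrel\tau\to y_1\Box x_2$, $x_2\Box x_1\stackrel\tau\to x_2\Box y_1$, $x_1\wedge x_2\stackrel\tau\to y_1\wedge x_2$, $x_2\wedge x_1\stackrel\tau\to x_2\wedge y_1$, $x_1\parallel_A x_2\stackrel\tau\to y_1\parallel_A x_2$, $x_2\parallel_A x_1\stackrel\tau\to x_2\parallel_A y_1$; if $x_1\stackrel a\to y_1$, $x_2\stackrel a\to y_2$ then $x_1\wedge x_2\stackrel a\to y_1\wedge y_2$, and if also $a\in A$ then $x_1\parallel_A x_2\stackrel a\to y_1\parallel_A y_2$; if $a\notin A$, $x_1\stackrel a\to y_1$, $x_2\not\stackrel\tau\to$ then $x_1\parallel_A x_2\stackrel a\to y_1\parallel_A x_2$ and $x_2\parallel_A x_1\stackrel a\to x_2\parallel_A y_1$; $x_1\vee x_2\stackrel\tau\to x_1$, $x_1\vee x_2\stackrel\tau\to x_2$; if $Y=t_Y\in E$ and $\langle t_Y|E\rangle\stackrel\alpha\to y$ then $\langle Y|E\rangle\stackrel\alpha\to y$. Predicate rules: $\bot\in F$; $x\in F\Rightarrow\alpha.x\in F$; $x_1,x_2\in F\Rightarrow x_1\vee x_2\in F$; if $x_1\in F$ or $x_2\in F$ then $x_1\Box x_2, x_1\parallel_A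 x_2, x_1\wedge x_2\in F$; if $x_1\wedge x_2\not\stackrel\tau\to$ and one of $x_1,x_2$ has an $a$-transition while the other has none, then $x_1\wedge x_2\in F$; if $x_1\wedge x_2\stackrel\alpha\to z$ for some $z$ and all $y$ with $x_1\wedge x_2\stackrel\alpha\to y$ are in $F$, then $x_1\wedge x_2\in F$; if all $y$ with $x_1\wedge x_2\stackrel\epsilon\Longrightarrow|y$ are in $F$ then $x_1\wedge x_2\in F$; if $Y=t_Y\in E$ and $\langle t_Y|E\rangle\in F$ then $\langle Y|E\rangle\in F$; if all $y$ with $\langle Y|E\rangle\stackrel\epsilon\Longrightarrow|y$ are in $F$ then $\langle Y|E\rangle\in F$. Notation: $\mathcal I(p)=\{\alpha:\exists q.\,p\stackrel\alpha\to q\}$; $p$ is stable iff $\tau\notin\mathcal I(p)$; $p\stackrel\epsilon\Longrightarrow_F|q$ means there is a sequence of $\tau$-transitions from $p$ to $q$ all of whose states (including $p$ and $q$) are not in $F$, and $q$ is stable. -}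

module Defs where

open import Data.Nat using (ℕ; _≡ᵇ_)
open import Data.Bool using (Bool; true; false; if_then_else_)
open import Data.Maybe using (Maybe; just; nothing)
open import Data.Product using (Σ; ∃; _×_; _,_; proj₁)
open import Data.Sum using (_⊎_)
open import Data.List using (List; []; _∷_; map)
open import Data.Bool.ListAction using (any)
open import Data.List.Membership.Propositional using (_∈_)
open import Data.List.Relation.Unary.Unique.Propositional using (Unique)
open import Relation.Nullary using (¬_)
open import Relation.Binary.PropositionalEquality using (_≡_)
open import Relation.Binary.Construct.Closure.ReflexiveTransitive using (Star)
open import Function.Bundles using (_⇔_)

module CLL (Act : Set) where

  data Actτ : Set where
    act : Act → Actτ
    τ   : Actτ

  Var : Set
  Var = ℕ

  -- Terms of CLL_R.  A ⊆ Act is represented by its characteristic function.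
  -- A recursive specification is a list of equations (Y , t_Y).
  data Term : Set where
    𝟎    : Term
    ⊥ₜ   : Term
    pre  : Actτ → Term → Term
    _□_  : Term → Term → Term
    _∧ₜ_ : Term → Term → Term
    _∨ₜ_ : Term → Term → Term
    par  : (Act → Bool) → Term → Term → Term
    var  : Var → Term
    rec  : Var → List (Var × Term) → Term

  Spec : Set
  Spec = List (Var × Term)

  dom : Spec → List Var
  dom = map proj₁

  inDom : Var → Spec → Bool
  inDom x E = any (λ e → proj₁ e ≡ᵇ x) E

  -- Substitution of (closed) terms for free variables; variables bound by an
  -- inner specification shadow the substitution.
  mutual
    subst : (Var → Maybe Term) → Term → Term
    subst σ 𝟎 = 𝟎
    subst σ ⊥ₜ = ⊥ₜ
    subst σ (pre α t) = pre α (subst σ t)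
    subst σ (t □ u) = subst σ t □ subst σ u
    subst σ (t ∧ₜ u) = subst σ t ∧ₜ subst σ u
    subst σ (t ∨ₜ u) = subst σ t ∨ₜ subst σ u
    subst σ (par A t u) = par A (subst σ t) (subst σ u)
    subst σ (var x) with σ x
    ... | just t  = t
    ... | nothing = var x
    subst σ (rec X E) = rec X (substSpec (λ x → if inDom x E then nothing else σ x) E)

    substSpec : (Var → Maybe Term) → Spec → Spec
    substSpec σ [] = []
    substSpec σ ((Y , t) ∷ E) = (Y , subst σ t) ∷ substSpec σ E

  ⟨_∣_⟩ : Term → Spec → Term
  ⟨ t ∣ E ⟩ = subst (λ x → if inDom x E then just (rec x E) else nothing) t

  data FreeIn (x : Var) : Term → Set where
    pre  : ∀ {α t} → FreeIn x t → FreeIn x (pre α t)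
    □l   : ∀ {t u} → FreeIn x t → FreeIn x (t □ u)
    □r   : ∀ {t u} → FreeIn x u → FreeIn x (t □ u)
    ∧l   : ∀ {t u} → FreeIn x t → FreeIn x (t ∧ₜ u)
    ∧r   : ∀ {t u} → FreeIn x u → FreeIn x (t ∧ₜ u)
    ∨l   : ∀ {t u} → FreeIn x t → FreeIn x (t ∨ₜ u)
    ∨r   : ∀ {t u} → FreeIn x u → FreeIn x (t ∨ₜ u)
    parl : ∀ {A t u} → FreeIn x t → FreeIn x (par A t u)
    parr : ∀ {A t u} → FreeIn x u → FreeIn x (par A t u)
    var  : FreeIn x (var x)
    rec  : ∀ {X E Y t} → ¬ (x ∈ dom E) → (Y , t) ∈ E → FreeIn x t → FreeIn x (rec X E)

  Closed : Term → Set
  Closed t = ∀ x → ¬ FreeIn x t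

  data Unguarded (V : List Var) : Term → Set where
    var  : ∀ {x} → x ∈ V → Unguarded V (var x)
    □l   : ∀ {t u} → Unguarded V t → Unguarded V (t □ u)
    □r   : ∀ {t u} → Unguarded V u → Unguarded V (t □ u)
    ∧l   : ∀ {t u} → Unguarded V t → Unguarded V (t ∧ₜ u)
    ∧r   : ∀ {t u} → Unguarded V u → Unguarded V (t ∧ₜ u)
    parl : ∀ {A t u} → Unguarded V t → Unguarded V (par A t u)
    parr : ∀ {A t u} → Unguarded V u → Unguarded V (par A t u)
    rec  : ∀ {X E Y t} → (Y , t) ∈ E → Unguarded V t → Unguarded V (rec X E)

  -- Well-formed terms: every specification ⟨X|E⟩ occurring has X ∈ V,
  -- distinct left-hand sides (so E is a set of equations, one per variable),
  -- and is guarded.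
  data WF : Term → Set where
    𝟎    : WF 𝟎
    ⊥ₜ   : WF ⊥ₜ
    pre  : ∀ {α t} → WF t → WF (pre α t)
    _□_  : ∀ {t u} → WF t → WF u → WF (t □ u)
    _∧ₜ_ : ∀ {t u} → WF t → WF u → WF (t ∧ₜ u)
    _∨ₜ_ : ∀ {t u} → WF t → WF u → WF (t ∨ₜ u)
    par  : ∀ {A t u} → WF t → WF u → WF (par A t u)
    var  : ∀ {x} → WF (var x)
    rec  : ∀ {X E} → X ∈ dom E → Unique (dom E)
         → (∀ {Y t} → (Y , t) ∈ E → ¬ Unguarded (dom E) t)
         → (∀ {Y t} → (Y , t) ∈ E → WF t)
         → WF (rec X E)

  Process : Term → Set
  Process p = Closed p × WF p

  Rel : Set₁
  Rel = Term → Actτ → Term → Set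

  -- Operational rules.  Positive premises refer to the inductive relation
  -- itself; negative premises are evaluated against the candidate model N
  -- (Gelfond–Lifschitz reduct).
  data Step (N : Rel) : Rel where
    pre   : ∀ {α x} → Step N (pre α x) α x
    □l-a  : ∀ {a x₁ x₂ y₁} → Step N x₁ (act a) y₁ → (∀ z → ¬ N x₂ τ z) → Step N (x₁ □ x₂) (act a) y₁
    □r-a  : ∀ {a x₁ x₂ y₁} → Step N x₁ (act a) y₁ → (∀ z → ¬ N x₂ τ z) → Step N (x₂ □ x₁) (act a) y₁
    □l-τ  : ∀ {x₁ x₂ y₁} → Step N x₁ τ y₁ → Step N (x₁ □ x₂) τ (y₁ □ x₂)
    □r-τ  : ∀ {x₁ x₂ y₁} → Step N x₁ τ y₁ → Step N (x₂ □ x₁) τ (x₂ □ y₁)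
    ∧l-τ  : ∀ {x₁ x₂ y₁} → Step N x₁ τ y₁ → Step N (x₁ ∧ₜ x₂) τ (y₁ ∧ₜ x₂)
    ∧r-τ  : ∀ {x₁ x₂ y₁} → Step N x₁ τ y₁ → Step N (x₂ ∧ₜ x₁) τ (x₂ ∧ₜ y₁)
    parl-τ : ∀ {A x₁ x₂ y₁} → Step N x₁ τ y₁ → Step N (par A x₁ x₂) τ (par A y₁ x₂)
    parr-τ : ∀ {A x₁ x₂ y₁} → Step N x₁ τ y₁ → Step N (par A x₂ x₁) τ (par A x₂ y₁)
    ∧-a   : ∀ {a x₁ x₂ y₁ y₂} → Step N x₁ (act a) y₁ → Step N x₂ (act a) y₂ → Step N (x₁ ∧ₜ x₂) (act a) (y₁ ∧ₜ y₂)
    par-sync : ∀ {A a x₁ x₂ y₁ y₂} → A a ≡ true → Step N x₁ (act a) y₁ → Step N x₂ (act a) y₂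
             → Step N (par A x₁ x₂) (act a) (par A y₁ y₂)
    parl-a : ∀ {A a x₁ x₂ y₁} → A a ≡ false → Step N x₁ (act a) y₁ → (∀ z → ¬ N x₂ τ z)
           → Step N (par A x₁ x₂) (act a) (par A y₁ x₂)
    parr-a : ∀ {A a x₁ x₂ y₁} → A a ≡ false → Step N x₁ (act a) y₁ → (∀ z → ¬ N x₂ τ z)
           → Step N (par A x₂ x₁) (act a) (par A x₂ y₁)
    ∨l    : ∀ {x₁ x₂} → Step N (x₁ ∨ₜ x₂) τ x₁
    ∨r    : ∀ {x₁ x₂} → Step N (x₁ ∨ₜ x₂) τ x₂
    rec   : ∀ {Y E tY α y} → (Y , tY) ∈ E → Step N ⟨ tY ∣ E ⟩ α y → Step N (rec Y E) α y

  _⟹ε∣_[_] : Term → Term → Rel → Set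
  z ⟹ε∣ y [ T ] = Star (λ u v → T u τ v) z y × (∀ w → ¬ T y τ w)

  -- Predicate rules for the inconsistency predicate, given the (lower
  -- stratum) transition relation T.
  data FInd (T : Rel) : Term → Set where
    ⊥ₜ   : FInd T ⊥ₜ
    pre  : ∀ {α x} → FInd T x → FInd T (pre α x)
    ∨ₜ   : ∀ {x₁ x₂} → FInd T x₁ → FInd T x₂ → FInd T (x₁ ∨ₜ x₂)
    □l   : ∀ {x₁ x₂} → FInd T x₁ → FInd T (x₁ □ x₂)
    □r   : ∀ {x₁ x₂} → FInd T x₂ → FInd T (x₁ □ x₂)
    parl : ∀ {A x₁ x₂} → FInd T x₁ → FInd T (par A x₁ x₂)
    parr : ∀ {A x₁ x₂} → FInd T x₂ → FInd T (par A x₁ x₂)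
    ∧l   : ∀ {x₁ x₂} → FInd T x₁ → FInd T (x₁ ∧ₜ x₂)
    ∧r   : ∀ {x₁ x₂} → FInd T x₂ → FInd T (x₁ ∧ₜ x₂)
    ∧-mismatch : ∀ {x₁ x₂ a} → (∀ z → ¬ T (x₁ ∧ₜ x₂) τ z)
               → ((∃ λ y → T x₁ (act a) y) × (∀ y → ¬ T x₂ (act a) y))
                 ⊎ ((∃ λ y → T x₂ (act a) y) × (∀ y → ¬ T x₁ (act a) y))
               → FInd T (x₁ ∧ₜ x₂)
    ∧-all : ∀ {x₁ x₂ α z} → T (x₁ ∧ₜ x₂) α z → (∀ y → T (x₁ ∧ₜ x₂) α y → FInd T y) → FInd T (x₁ ∧ₜ x₂)
    ∧-div : ∀ {x₁ x₂} → (∀ y → (x₁ ∧ₜ x₂) ⟹ε∣ y [ T ] → FInd T y) → FInd T (x₁ ∧ₜ x₂)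
    rec   : ∀ {Y E tY} → (Y , tY) ∈ E → FInd T ⟨ tY ∣ E ⟩ → FInd T (rec Y E)
    rec-div : ∀ {Y E} → (∀ y → rec Y E ⟹ε∣ y [ T ] → FInd T y) → FInd T (rec Y E)

  -- (T , F) is a stable model of the stratified TSS: T coincides with the
  -- least model of the reduct w.r.t. T, and F with the least model of the
  -- predicate rules given T.
  IsStableModel : Rel → (Term → Set) → Set
  IsStableModel T F = (∀ p α q → T p α q ⇔ Step T p α q) × (∀ p → F p ⇔ FInd T p)

  𝓘 : Rel → Term → Actτ → Set
  𝓘 T p α = ∃ λ q → T p α q

  data NFPath (T : Rel) (F : Term → Set) : Term → Term → Set where
    [] : ∀ {p} → ¬ F p → NFPath T F p p
    _∷_ : ∀ {p p' q} → (¬ F p) × T p τ p' → NFPath T F p' q → NFPath T F p q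

  _⟹εF∣_[_,_] : Term → Term → Rel → (Term → Set) → Set
  p ⟹εF∣ q [ T , F ] = NFPath T F p q × (∀ w → ¬ T q τ w)

  LTS1 : Rel → (Term → Set) → Term → Set
  LTS1 T F p = ∀ α → 𝓘 T p α → (∀ q → T p α q → F q) → F p

  LTS2 : Rel → (Term → Set) → Term → Set
  LTS2 T F p = ¬ (∃ λ q → p ⟹εF∣ q [ T , F ]) → F p

module Submission where

open import Defs
open import Data.Product using (_×_)
open import Level using (0ℓ)
open import Axiom.ExcludedMiddle using (ExcludedMiddle)

open import Data.Bool using (true; false; if_then_else_)
open import Data.Maybe using (Maybe; just; nothing)
open import Data.Product using (Σ; _,_; proj₁; proj₂)
open import Data.Sum using (_⊎_; inj₁; inj₂; [_,_]′; fromInj₁; fromInj₂; swap)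
open import Data.List using (_∷_)
open import Data.List.Relation.Unary.Any using (here; there)
open import Data.List.Relation.Unary.All as All using ()
open import Data.List.Relation.Unary.All.Properties using (map⁻)
open import Data.List.Relation.Unary.AllPairs using (_∷_)
open import Data.List.Membership.Propositional using (_∈_)
open import Data.List.Relation.Unary.Unique.Propositional using (Unique)
open import Relation.Nullary using (¬_; yes; no; contradiction)
open import Relation.Binary.PropositionalEquality using (_≡_; refl; cong)
open import Relation.Binary.Construct.Closure.ReflexiveTransitive using (Star; ε; _◅_; _◅◅_; gmap)
open import Function using (_∘_)
open import Function.Bundles using (Equivalence)

-- LTS1 is proved by induction on the derivation of an α-transition of p:
-- for □ and ∥ either the component that does not move is inconsistent, or
-- (classically) all successors of the moving component are and the induction
-- hypothesis applies; for ∧ it is a predicate rule.  For LTS2, two facts are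
-- combined.  First, F is closed under τ-steps, so if some τ-path from p
-- reaches a consistent stable state then the whole path is consistent; hence,
-- without such a path, every stable τ-descendant of p is inconsistent.
-- Second, a term all of whose stable τ-descendants are inconsistent is itself
-- inconsistent, by induction on the term: ∧ and recursion have predicate rules
-- for exactly this, and □, ∥ are split classically as above.  Both facts only
-- need the specifications occurring in p to be functional, an invariant of
-- substitution and of transitions.

module FunctionalSpecifications (Act : Set) where
  open CLL Act

  Functional : Spec → Set
  Functional E = ∀ {Y t t'} → (Y , t) ∈ E → (Y , t') ∈ E → t ≡ t'

  data FunctionalSpecs : Term → Set where
    𝟎    : FunctionalSpecs 𝟎
    ⊥ₜ   : FunctionalSpecs ⊥ₜ
    pre  : ∀ {α t} → FunctionalSpecs t → FunctionalSpecs (pre α t)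
    _□_  : ∀ {t u} → FunctionalSpecs t → FunctionalSpecs u → FunctionalSpecs (t □ u)
    _∧ₜ_ : ∀ {t u} → FunctionalSpecs t → FunctionalSpecs u → FunctionalSpecs (t ∧ₜ u)
    _∨ₜ_ : ∀ {t u} → FunctionalSpecs t → FunctionalSpecs u → FunctionalSpecs (_∨ₜ_ t u)
    par  : ∀ {A t u} → FunctionalSpecs t → FunctionalSpecs u → FunctionalSpecs (par A t u)
    var  : ∀ {x} → FunctionalSpecs (var x)
    rec  : ∀ {X E} → Functional E → (∀ {Y t} → (Y , t) ∈ E → FunctionalSpecs t)
         → FunctionalSpecs (rec X E)

  ∈-substSpec⁻ : ∀ σ E {Y t'} → (Y , t') ∈ substSpec σ E
               → Σ Term λ t → (Y , t) ∈ E × t' ≡ subst σ t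
  ∈-substSpec⁻ σ ((Y , t) ∷ E) (here refl) = t , here refl , refl
  ∈-substSpec⁻ σ (_ ∷ E) (there m) with ∈-substSpec⁻ σ E m
  ... | t , m' , eq = t , there m' , eq

  functionalSpecs-subst : ∀ σ → (∀ {x t} → σ x ≡ just t → FunctionalSpecs t)
                        → ∀ {t} → FunctionalSpecs t → FunctionalSpecs (subst σ t)
  functionalSpecs-subst σ fσ 𝟎 = 𝟎
  functionalSpecs-subst σ fσ ⊥ₜ = ⊥ₜ
  functionalSpecs-subst σ fσ (pre f) = pre (functionalSpecs-subst σ fσ f)
  functionalSpecs-subst σ fσ (f □ g) =
    functionalSpecs-subst σ fσ f □ functionalSpecs-subst σ fσ g
  functionalSpecs-subst σ fσ (f ∧ₜ g) =
    functionalSpecs-subst σ fσ f ∧ₜ functionalSpecs-subst σ fσ g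
  functionalSpecs-subst σ fσ (_∨ₜ_ f g) =
    _∨ₜ_ (functionalSpecs-subst σ fσ f) (functionalSpecs-subst σ fσ g)
  functionalSpecs-subst σ fσ (par f g) =
    par (functionalSpecs-subst σ fσ f) (functionalSpecs-subst σ fσ g)
  functionalSpecs-subst σ fσ (var {x}) with σ x in eq
  ... | just t  = fσ eq
  ... | nothing = var
  functionalSpecs-subst σ fσ (rec {E = E} functional bodies) = rec functional' bodies'
    where
    σ' : Var → Maybe Term
    σ' x = if inDom x E then nothing else σ x

    fσ' : ∀ {x t} → σ' x ≡ just t → FunctionalSpecs t
    fσ' {x} eq with inDom x E
    ... | false = fσ eq

    functional' : Functional (substSpec σ' E)
    functional' m m' with ∈-substSpec⁻ σ' E m | ∈-substSpec⁻ σ' E m'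
    ... | _ , n , refl | _ , n' , refl = cong (subst σ') (functional n n')

    bodies' : ∀ {Y t} → (Y , t) ∈ substSpec σ' E → FunctionalSpecs t
    bodies' m with ∈-substSpec⁻ σ' E m
    ... | _ , n , refl = functionalSpecs-subst σ' fσ' (bodies n)

  functionalSpecs-unfold : ∀ {X E Y tY} → FunctionalSpecs (rec X E) → (Y , tY) ∈ E
                         → FunctionalSpecs ⟨ tY ∣ E ⟩
  functionalSpecs-unfold {E = E} (rec functional bodies) m = functionalSpecs-subst _ unfold (bodies m)
    where
    unfold : ∀ {x t} → (if inDom x E then just (rec x E) else nothing) ≡ just t
              → FunctionalSpecs t
    unfold {x} eq with inDom x E
    unfold refl | true = rec functional bodies

  functionalSpecs-step : ∀ {N p α q} → FunctionalSpecs p → Step N p α q → FunctionalSpecs q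
  functionalSpecs-step (pre f) pre = f
  functionalSpecs-step (f □ g) (□l-a s _) = functionalSpecs-step f s
  functionalSpecs-step (f □ g) (□r-a s _) = functionalSpecs-step g s
  functionalSpecs-step (f □ g) (□l-τ s) = functionalSpecs-step f s □ g
  functionalSpecs-step (f □ g) (□r-τ s) = f □ functionalSpecs-step g s
  functionalSpecs-step (f ∧ₜ g) (∧l-τ s) = functionalSpecs-step f s ∧ₜ g
  functionalSpecs-step (f ∧ₜ g) (∧r-τ s) = f ∧ₜ functionalSpecs-step g s
  functionalSpecs-step (f ∧ₜ g) (∧-a s s') = functionalSpecs-step f s ∧ₜ functionalSpecs-step g s'
  functionalSpecs-step (_∨ₜ_ f g) ∨l = f
  functionalSpecs-step (_∨ₜ_ f g) ∨r = g
  functionalSpecs-step (par f g) (parl-τ s) = par (functionalSpecs-step f s) g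
  functionalSpecs-step (par f g) (parr-τ s) = par f (functionalSpecs-step g s)
  functionalSpecs-step (par f g) (par-sync _ s s') = par (functionalSpecs-step f s) (functionalSpecs-step g s')
  functionalSpecs-step (par f g) (parl-a _ s _) = par (functionalSpecs-step f s) g
  functionalSpecs-step (par f g) (parr-a _ s _) = par f (functionalSpecs-step g s)
  functionalSpecs-step f (rec m s) = functionalSpecs-step (functionalSpecs-unfold f m) s

  unique⇒functional : ∀ {E} → Unique (dom E) → Functional E
  unique⇒functional (_ ∷ _) (here refl) (here refl) = refl
  unique⇒functional (fresh ∷ _) (here refl) (there m) = contradiction refl (All.lookup (map⁻ fresh) m)
  unique⇒functional (fresh ∷ _) (there m) (here refl) = contradiction refl (All.lookup (map⁻ fresh) m)
  unique⇒functional (_ ∷ unique) (there m) (there m') = unique⇒functional unique m m'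

  wf⇒functionalSpecs : ∀ {t} → WF t → FunctionalSpecs t
  wf⇒functionalSpecs 𝟎 = 𝟎
  wf⇒functionalSpecs ⊥ₜ = ⊥ₜ
  wf⇒functionalSpecs (pre w) = pre (wf⇒functionalSpecs w)
  wf⇒functionalSpecs (w □ v) = wf⇒functionalSpecs w □ wf⇒functionalSpecs v
  wf⇒functionalSpecs (w ∧ₜ v) = wf⇒functionalSpecs w ∧ₜ wf⇒functionalSpecs v
  wf⇒functionalSpecs (_∨ₜ_ w v) = _∨ₜ_ (wf⇒functionalSpecs w) (wf⇒functionalSpecs v)
  wf⇒functionalSpecs (par w v) = par (wf⇒functionalSpecs w) (wf⇒functionalSpecs v)
  wf⇒functionalSpecs var = var
  wf⇒functionalSpecs (rec _ unique _ bodies) = rec (unique⇒functional unique) (wf⇒functionalSpecs ∘ bodies)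

module StableModel (lem : ExcludedMiddle 0ℓ) (Act : Set) where
  open CLL Act
  open FunctionalSpecifications Act

  module _ (T : Rel) (F : Term → Set) (model : IsStableModel T F) where

    toStep : ∀ {p α q} → T p α q → Step T p α q
    toStep = Equivalence.to (proj₁ model _ _ _)

    fromStep : ∀ {p α q} → Step T p α q → T p α q
    fromStep = Equivalence.from (proj₁ model _ _ _)

    toFInd : ∀ {p} → F p → FInd T p
    toFInd = Equivalence.to (proj₂ model _)

    fromFInd : ∀ {p} → FInd T p → F p
    fromFInd = Equivalence.from (proj₂ model _)

    Stable : Term → Set
    Stable p = ∀ w → ¬ T p τ w

    SuccessorsInF : Term → Actτ → Set
    SuccessorsInF p α = ∀ q → T p α q → F q

    StableDescendantsInF : Term → Set
    StableDescendantsInF p = ∀ y → p ⟹ε∣ y [ T ] → F y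

    F-□⁻ : ∀ {x y} → F (x □ y) → F x ⊎ F y
    F-□⁻ Fxy with toFInd Fxy
    ... | □l Fx = inj₁ (fromFInd Fx)
    ... | □r Fy = inj₂ (fromFInd Fy)

    F-par⁻ : ∀ {A x y} → F (par A x y) → F x ⊎ F y
    F-par⁻ Fxy with toFInd Fxy
    ... | parl Fx = inj₁ (fromFInd Fx)
    ... | parr Fy = inj₂ (fromFInd Fy)

    successorsInF-in-context : ∀ {p α x β c} (C : Term → Term)
      → (∀ {y} → T x β y → T p α (C y))
      → (∀ {y} → F (C y) → F y ⊎ F c)
      → (SuccessorsInF x β → FInd T x)
      → SuccessorsInF p α → FInd T x ⊎ FInd T c
    successorsInF-in-context {c = c} C lift split ih all with lem {F c}
    ... | yes Fc = inj₂ (toFInd Fc)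
    ... | no ¬Fc = inj₁ (ih λ y x→y →
      fromInj₁ (λ Fc → contradiction Fc ¬Fc) (split (all (C y) (lift x→y))))

    successorsInF⇒F : ∀ {p α q} → Step T p α q → SuccessorsInF p α → FInd T p
    successorsInF⇒F pre all = pre (toFInd (all _ (fromStep pre)))
    successorsInF⇒F (□l-a s idle) all =
      □l (successorsInF⇒F s λ y t → all y (fromStep (□l-a (toStep t) idle)))
    successorsInF⇒F (□r-a s idle) all =
      □r (successorsInF⇒F s λ y t → all y (fromStep (□r-a (toStep t) idle)))
    successorsInF⇒F (□l-τ {x₂ = x₂} s) all = [ □l , □r ]′
      (successorsInF-in-context (_□ x₂) (fromStep ∘ □l-τ ∘ toStep) F-□⁻ (successorsInF⇒F s) all)
    successorsInF⇒F (□r-τ {x₂ = x₂} s) all = [ □r , □l ]′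
      (successorsInF-in-context (x₂ □_) (fromStep ∘ □r-τ ∘ toStep) (swap ∘ F-□⁻)
        (successorsInF⇒F s) all)
    successorsInF⇒F s@(∧l-τ _) all = ∧-all (fromStep s) (λ y t → toFInd (all y t))
    successorsInF⇒F s@(∧r-τ _) all = ∧-all (fromStep s) (λ y t → toFInd (all y t))
    successorsInF⇒F s@(∧-a _ _) all = ∧-all (fromStep s) (λ y t → toFInd (all y t))
    successorsInF⇒F (parl-τ {A} {x₂ = x₂} s) all = [ parl , parr ]′
      (successorsInF-in-context (λ y → par A y x₂) (fromStep ∘ parl-τ ∘ toStep) F-par⁻
        (successorsInF⇒F s) all)
    successorsInF⇒F (parr-τ {A} {x₂ = x₂} s) all = [ parr , parl ]′
      (successorsInF-in-context (par A x₂) (fromStep ∘ parr-τ ∘ toStep) (swap ∘ F-par⁻)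
        (successorsInF⇒F s) all)
    successorsInF⇒F (parl-a {A} {x₂ = x₂} a∉A s idle) all = [ parl , parr ]′
      (successorsInF-in-context (λ y → par A y x₂) (λ t → fromStep (parl-a a∉A (toStep t) idle))
        F-par⁻        (successorsInF⇒F s) all)
    successorsInF⇒F (parr-a {A} {x₂ = x₂} a∉A s idle) all = [ parr , parl ]′
      (successorsInF-in-context (par A x₂) (λ t → fromStep (parr-a a∉A (toStep t) idle))
        (swap ∘ F-par⁻)        (successorsInF⇒F s) all)
    successorsInF⇒F (par-sync {A} {x₁ = x₁} a∈A s₁ s₂) all with lem {FInd T x₁}
    ... | yes Fx₁ = parl Fx₁
    ... | no ¬Fx₁ = parr (successorsInF⇒F s₂ λ y₂ t₂ →
      fromFInd (fromInj₂ (λ Fx₁ → contradiction Fx₁ ¬Fx₁)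
        (successorsInF-in-context (λ y₁ → par A y₁ y₂)
          (λ t₁ → fromStep (par-sync a∈A (toStep t₁) (toStep t₂))) F-par⁻ (successorsInF⇒F s₁) all)))
    successorsInF⇒F ∨l all = ∨ₜ (toFInd (all _ (fromStep ∨l))) (toFInd (all _ (fromStep ∨r)))
    successorsInF⇒F ∨r all = ∨ₜ (toFInd (all _ (fromStep ∨l))) (toFInd (all _ (fromStep ∨r)))
    successorsInF⇒F (rec m s) all =
      rec m (successorsInF⇒F s λ y t → all y (fromStep (rec m (toStep t))))

    lts1 : ∀ p → LTS1 T F p
    lts1 p α (q , p→q) all = fromFInd (successorsInF⇒F (toStep p→q) all)

    visible⇒¬τ : ∀ {p a q q'} → FunctionalSpecs p → Step T p (act a) q → ¬ Step T p τ q'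
    visible⇒¬τ (f □ g) (□l-a s idle) (□l-τ s') = visible⇒¬τ f s s'
    visible⇒¬τ (f □ g) (□l-a s idle) (□r-τ s') = idle _ (fromStep s')
    visible⇒¬τ (f □ g) (□r-a s idle) (□l-τ s') = idle _ (fromStep s')
    visible⇒¬τ (f □ g) (□r-a s idle) (□r-τ s') = visible⇒¬τ g s s'
    visible⇒¬τ (f ∧ₜ g) (∧-a s _) (∧l-τ s') = visible⇒¬τ f s s'
    visible⇒¬τ (f ∧ₜ g) (∧-a _ s) (∧r-τ s') = visible⇒¬τ g s s'
    visible⇒¬τ (par f g) (par-sync _ s _) (parl-τ s') = visible⇒¬τ f s s'
    visible⇒¬τ (par f g) (par-sync _ _ s) (parr-τ s') = visible⇒¬τ g s s'
    visible⇒¬τ (par f g) (parl-a _ s idle) (parl-τ s') = visible⇒¬τ f s s'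
    visible⇒¬τ (par f g) (parl-a _ s idle) (parr-τ s') = idle _ (fromStep s')
    visible⇒¬τ (par f g) (parr-a _ s idle) (parl-τ s') = idle _ (fromStep s')
    visible⇒¬τ (par f g) (parr-a _ s idle) (parr-τ s') = visible⇒¬τ g s s'
    visible⇒¬τ f@(rec functional _) (rec m s) (rec m' s') with functional m m'
    ... | refl = visible⇒¬τ (functionalSpecs-unfold f m) s s'

    stableDescendantsInF⇒F-stable : ∀ {p} → Stable p → StableDescendantsInF p → FInd T p
    stableDescendantsInF⇒F-stable stable inF = toFInd (inF _ (ε , stable))

    stable-𝟎 : Stable 𝟎
    stable-𝟎 _ t with toStep t
    ... | ()

    stable-var : ∀ {x} → Stable (var x)
    stable-var _ t with toStep t
    ... | ()

    stable-act : ∀ {a x} → Stable (pre (act a) x)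
    stable-act _ t with toStep t
    ... | ()

    stable-□ : ∀ {x y} → Stable x → Stable y → Stable (x □ y)
    stable-□ stable₁ stable₂ _ t with toStep t
    ... | □l-τ s = stable₁ _ (fromStep s)
    ... | □r-τ s = stable₂ _ (fromStep s)

    stable-par : ∀ {A x y} → Stable x → Stable y → Stable (par A x y)
    stable-par stable₁ stable₂ _ t with toStep t
    ... | parl-τ s = stable₁ _ (fromStep s)
    ... | parr-τ s = stable₂ _ (fromStep s)

    stableDescendantsInF-τ : ∀ {p p'} → T p τ p' → StableDescendantsInF p → StableDescendantsInF p'
    stableDescendantsInF-τ p→p' inF y (path , stable) = inF y (p→p' ◅ path , stable)

    -- If x₁ has a consistent stable descendant y₁, then every stable
    -- descendant y₂ of x₂ is inconsistent, as C y₁ y₂ is one of C x₁ x₂.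
    stableDescendantsInF-in-context : ∀ {x₁ x₂} (C : Term → Term → Term)
      → (∀ {y₁ y₁' y₂} → T y₁ τ y₁' → T (C y₁ y₂) τ (C y₁' y₂))
      → (∀ {y₁ y₂ y₂'} → T y₂ τ y₂' → T (C y₁ y₂) τ (C y₁ y₂'))
      → (∀ {y₁ y₂} → Stable y₁ → Stable y₂ → Stable (C y₁ y₂))
      → (∀ {y₁ y₂} → F (C y₁ y₂) → F y₁ ⊎ F y₂)
      → StableDescendantsInF (C x₁ x₂) → StableDescendantsInF x₁ ⊎ StableDescendantsInF x₂
    stableDescendantsInF-in-context {x₁} {x₂} C liftˡ liftʳ stable split inF
      with lem {StableDescendantsInF x₁}
    ... | yes inF₁ = inj₁ inF₁
    ... | no ¬inF₁ = inj₂ inF₂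
      where
      inF₂ : StableDescendantsInF x₂
      inF₂ y₂ (path₂ , stable₂) with lem {F y₂}
      ... | yes Fy₂ = Fy₂
      ... | no ¬Fy₂ = contradiction inF₁ ¬inF₁
        where
        inF₁ : StableDescendantsInF x₁
        inF₁ y₁ (path₁ , stable₁) = fromInj₁ (λ Fy₂ → contradiction Fy₂ ¬Fy₂)
          (split (inF (C y₁ y₂)
            (gmap (λ z → C z x₂) liftˡ path₁ ◅◅ gmap (C y₁) liftʳ path₂ , stable stable₁ stable₂)))

    stableDescendantsInF⇒F : ∀ p → StableDescendantsInF p → FInd T p
    stableDescendantsInF⇒F 𝟎 = stableDescendantsInF⇒F-stable stable-𝟎
    stableDescendantsInF⇒F ⊥ₜ _ = ⊥ₜ
    stableDescendantsInF⇒F (pre (act a) x) = stableDescendantsInF⇒F-stable stable-act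
    stableDescendantsInF⇒F (pre τ x) inF =
      pre (stableDescendantsInF⇒F x (stableDescendantsInF-τ (fromStep pre) inF))
    stableDescendantsInF⇒F (x₁ □ x₂) inF =
      [ □l ∘ stableDescendantsInF⇒F x₁ , □r ∘ stableDescendantsInF⇒F x₂ ]′
      (stableDescendantsInF-in-context _□_ (fromStep ∘ □l-τ ∘ toStep) (fromStep ∘ □r-τ ∘ toStep)
        stable-□ F-□⁻ inF)
    stableDescendantsInF⇒F (x₁ ∧ₜ x₂) inF = ∧-div (λ y r → toFInd (inF y r))
    stableDescendantsInF⇒F (_∨ₜ_ x₁ x₂) inF =
      ∨ₜ (stableDescendantsInF⇒F x₁ (stableDescendantsInF-τ (fromStep ∨l) inF))
         (stableDescendantsInF⇒F x₂ (stableDescendantsInF-τ (fromStep ∨r) inF))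
    stableDescendantsInF⇒F (par A x₁ x₂) inF =
      [ parl ∘ stableDescendantsInF⇒F x₁ , parr ∘ stableDescendantsInF⇒F x₂ ]′
      (stableDescendantsInF-in-context (par A) (fromStep ∘ parl-τ ∘ toStep) (fromStep ∘ parr-τ ∘ toStep)
        stable-par F-par⁻ inF)
    stableDescendantsInF⇒F (var x) = stableDescendantsInF⇒F-stable stable-var
    stableDescendantsInF⇒F (rec X E) inF = rec-div (λ y r → toFInd (inF y r))

    FInd-τ-step : ∀ {s s'} → FunctionalSpecs s → FInd T s → Step T s τ s' → FInd T s'
    FInd-τ-step _ (pre Fx) pre = Fx
    FInd-τ-step _ (∨ₜ Fx₁ _) ∨l = Fx₁
    FInd-τ-step _ (∨ₜ _ Fx₂) ∨r = Fx₂
    FInd-τ-step (f □ _) (□l Fx) (□l-τ s) = □l (FInd-τ-step f Fx s)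
    FInd-τ-step _ (□l Fx) (□r-τ _) = □l Fx
    FInd-τ-step _ (□r Fx) (□l-τ _) = □r Fx
    FInd-τ-step (_ □ g) (□r Fx) (□r-τ s) = □r (FInd-τ-step g Fx s)
    FInd-τ-step (par f _) (parl Fx) (parl-τ s) = parl (FInd-τ-step f Fx s)
    FInd-τ-step _ (parl Fx) (parr-τ _) = parl Fx
    FInd-τ-step _ (parr Fx) (parl-τ _) = parr Fx
    FInd-τ-step (par _ g) (parr Fx) (parr-τ s) = parr (FInd-τ-step g Fx s)
    FInd-τ-step (f ∧ₜ _) (∧l Fx) (∧l-τ s) = ∧l (FInd-τ-step f Fx s)
    FInd-τ-step _ (∧l Fx) (∧r-τ _) = ∧l Fx
    FInd-τ-step _ (∧r Fx) (∧l-τ _) = ∧r Fx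
    FInd-τ-step (_ ∧ₜ g) (∧r Fx) (∧r-τ s) = ∧r (FInd-τ-step g Fx s)
    FInd-τ-step _ (∧-mismatch stable _) s = contradiction (fromStep s) (stable _)
    FInd-τ-step _ (∧-all {α = τ} _ all) s = all _ (fromStep s)
    FInd-τ-step f (∧-all {α = act a} t _) s = contradiction s (visible⇒¬τ f (toStep t))
    FInd-τ-step _ (∧-div inF) s@(∧l-τ _) = ∧-div λ y (path , stable) → inF y (fromStep s ◅ path , stable)
    FInd-τ-step _ (∧-div inF) s@(∧r-τ _) = ∧-div λ y (path , stable) → inF y (fromStep s ◅ path , stable)
    FInd-τ-step f@(rec functional _) (rec m Fx) (rec m' s) with functional m m'
    ... | refl = FInd-τ-step (functionalSpecs-unfold f m) Fx s
    FInd-τ-step _ (rec-div inF) s = stableDescendantsInF⇒F _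
      (stableDescendantsInF-τ (fromStep s) (λ y r → fromFInd (inF y r)))

    NFPath-source¬F : ∀ {p q} → NFPath T F p q → ¬ F p
    NFPath-source¬F ([] ¬Fp) = ¬Fp
    NFPath-source¬F ((¬Fp , _) ∷ _) = ¬Fp

    -- Backwards along the path, using that F is closed under τ-steps.
    τ*-target¬F⇒NFPath : ∀ {s y} → FunctionalSpecs s → Star (λ u v → T u τ v) s y → ¬ F y
                       → NFPath T F s y
    τ*-target¬F⇒NFPath _ ε ¬Fy = [] ¬Fy
    τ*-target¬F⇒NFPath f (s→s' ◅ path) ¬Fy = (¬Fs , s→s') ∷ rest
      where
      rest = τ*-target¬F⇒NFPath (functionalSpecs-step f (toStep s→s')) path ¬Fy
      ¬Fs = λ Fs → NFPath-source¬F rest (fromFInd (FInd-τ-step f (toFInd Fs) (toStep s→s')))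

    lts2 : ∀ {p} → FunctionalSpecs p → LTS2 T F p
    lts2 {p} f noPath = fromFInd (stableDescendantsInF⇒F p inF)
      where
      inF : StableDescendantsInF p
      inF y (path , stable) with lem {F y}
      ... | yes Fy = Fy
      ... | no ¬Fy = contradiction (y , τ*-target¬F⇒NFPath f path ¬Fy , stable) noPath

mainTheorem6 : ExcludedMiddle 0ℓ → (Act : Set) → let open CLL Act in
    ∀ (T : Rel) (F : Term → Set) → IsStableModel T F →
      ∀ p → Process p → LTS1 T F p × LTS2 T F p
mainTheorem6 lem Act T F model p (_ , wf) = lts1 T F model p , lts2 T F model (wf⇒functionalSpecs wf)
  where
  open FunctionalSpecifications Act
  open StableModel lem Act
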